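{- Let $n\ge 2$ and let $d_1 \ge d_2 \ge \dots \ge d_n \ge 1$ be integers, indexed by the vertex set $V=\{1,\dots,n\}$. Fix an arbitrary vertex $i \in V$, an integer $m$ with $0\le m \le n-1-d_i$, and a set $X(i)=\{j_1,\dots,j_m\}\subset V\setminus\{i\}$ of $m$ vertices (the forbidden connections for $i$). Let $L(i)=\{l_1,\dots,l_{d_i}\}$ be the set of the $d_i$ smallest-index vertices of $V\setminus (X(i)\cup\{i\})$. Then there exists a simple graph $G(V,E)$ in which every vertex $k$ has degree $d_k$ and $(i,j)\notin E$ for all $j\in X(i)$ if and only if the sequence $\mathbf{d}'|_{L(i)}=(d'_1,\dots,d'_n)$ defined by $d'_k = d_k-1$ if $k\in L(i)$, $d'_k=d_k$ if $k\in V\setminus(L(i)\cup\{i\})$, and $d'_i=0$, is graphical.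
   Context: A simple graph has no self-loops and no multiple edges. A sequence $(c_1,\dots,c_n)$ of nonnegative integers is called graphical if there is a simple graph on vertex set $\{1,\dots,n\}$ in which vertex $k$ has degree $c_k$ for every $k$ (the sequence need not be ordered). The set $L(i)$ is called the leftmost adjacency set of $i$ restricted by $X(i)$, and $\mathbf{d}'|_{L(i)}$ is the degree sequence reduced by $L(i)$. -}

module Defs where

open import Data.Nat using (ℕ; zero; suc; _+_; _∸_; _≤_; _<_; _≥_)
open import Data.Bool using (Bool; true; false; _∧_; not)
open import Data.Fin using (Fin; toℕ; _≟_)
open import Data.Fin.Subset using (Subset; ∣_∣; _∈_; _∉_)
open import Data.Vec using (tabulate; lookup)
open import Data.Product using (Σ; _×_; _,_)
open import Relation.Binary.PropositionalEquality using (_≡_)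
open import Relation.Nullary.Decidable using (⌊_⌋)

record SimpleGraph (n : ℕ) : Set where
  field
    adj       : Fin n → Fin n → Bool
    symmetric : ∀ u v → adj u v ≡ adj v u
    loopless  : ∀ v → adj v v ≡ false
open SimpleGraph public

nbhd : ∀ {n} → SimpleGraph n → Fin n → Subset n
nbhd G v = tabulate (adj G v)

degree : ∀ {n} → SimpleGraph n → Fin n → ℕ
degree G v = ∣ nbhd G v ∣

Graphical : ∀ {n} → (Fin n → ℕ) → Set
Graphical {n} c = Σ (SimpleGraph n) λ G → ∀ k → degree G k ≡ c k

NonIncreasing : ∀ {n} → (Fin n → ℕ) → Set
NonIncreasing {n} d = ∀ (a b : Fin n) → toℕ a ≤ toℕ b → d b ≤ d a

allowed : ∀ {n} → Subset n → Fin n → Fin n → Bool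
allowed X i k = not (lookup X k) ∧ not ⌊ k ≟ i ⌋

allowedBelow : ∀ {n} → Subset n → Fin n → Fin n → ℕ
allowedBelow {n} X i k =
  ∣ tabulate (λ j → allowed X i j ∧ ⌊ toℕ j Data.Nat.<? toℕ k ⌋) ∣
  where import Data.Nat

leftmost : ∀ {n} → Subset n → Fin n → ℕ → Subset n
leftmost X i di =
  tabulate (λ k → allowed X i k ∧ ⌊ allowedBelow X i k Data.Nat.<? di ⌋)
  where import Data.Nat

reduced : ∀ {n} → (Fin n → ℕ) → Subset n → Fin n → Fin n → ℕ
reduced d X i k with ⌊ k ≟ i ⌋ | lookup (leftmost X i (d i)) k
... | true  | _     = 0
... | false | true  = d k ∸ 1
... | false | false = d k

-- Let L = L(i) be the d i leftmost vertices outside X ∪ {i}.  The theorem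
-- says that d has a realisation in which i avoids X iff the sequence d
-- reduced by L is graphical.
--   (⇐) In a realisation of the reduced sequence, i is isolated; joining i
--       to every vertex of L restores exactly the degrees d.
--   (⇒) A realisation avoiding X is normalised by 2-switches until the
--       neighbourhood of i is exactly L.  If l ∈ L is not a neighbour of i,
--       some neighbour j of i lies outside L; as L consists of the leftmost,
--       hence heaviest, allowed vertices, d j ≤ d l, so l has a neighbour k
--       not adjacent to j.  Replacing ij, lk by il, jk keeps all degrees and
--       the avoidance of X, and joins i to one more vertex of L.  Finally,
--       deleting the edges at i realises the reduced sequence.
module Submission where

open import Defs
open import Data.Nat using (ℕ; zero; suc; _+_; _∸_; _≤_; _≥_; _<_; z≤n; s≤s⁻¹; s<s; s<s⁻¹; _<?_; _⊓_)
open import Data.Nat.Properties using (≤-refl; ≤-trans; +-mono-≤; <⇒≱; <⇒≢; m+n≡0⇒n≡0; n<1+n; module ≤-Reasoning; m≤n⇒m⊓n≡m; +-assoc; +-comm; m+n∸m≡n; m+[n∸m]≡n; ≤-reflexive; +-cancelˡ-≤; +-suc; ⊓-zeroʳ; <-≤-trans; ≤-<-trans; <⇒≤; ≮⇒≥; +-commutativeSemigroup)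
open import Data.Nat.Induction using (<-rec)
open import Algebra.Properties.CommutativeSemigroup +-commutativeSemigroup using (interchange; x∙yz≈y∙xz)
open import Data.Fin using (Fin; zero; suc; toℕ; _≟_)
open import Data.Fin.Properties using (any?; suc-injective)
open import Data.Fin.Subset using (Subset; ∣_∣; _∈_; _∉_)
open import Data.Vec using (lookup; tabulate)
open import Data.Vec.Properties using (lookup∘tabulate; tabulate∘lookup; []=⇒lookup; lookup⇒[]=)
open import Data.Bool using (Bool; true; false; _∧_; _∨_; not; if_then_else_)
import Data.Bool as Bool
open import Data.Bool.Properties using (∧-zeroʳ; ∧-identityʳ; ∧-comm; ∨-comm)
open import Data.Product using (Σ; _×_; _,_; proj₁; proj₂)
open import Data.Empty using (⊥-elim)
open import Relation.Nullary using (¬_; Dec; yes; no)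
open import Relation.Nullary.Decidable using (⌊_⌋; _×-dec_; isYes≗does; dec-true; dec-false; does-⇔)
open import Relation.Binary.PropositionalEquality
open import Function.Bundles using (_⇔_; mk⇔)

⌊⌋-true : ∀ {A : Set} (a? : Dec A) → A → ⌊ a? ⌋ ≡ true
⌊⌋-true a? a = trans (isYes≗does a?) (dec-true a? a)

⌊⌋-false : ∀ {A : Set} (a? : Dec A) → ¬ A → ⌊ a? ⌋ ≡ false
⌊⌋-false a? ¬a = trans (isYes≗does a?) (dec-false a? ¬a)

⌊⌋-sound : ∀ {A : Set} (a? : Dec A) → ⌊ a? ⌋ ≡ true → A
⌊⌋-sound (yes a) _ = a

⌊⌋-refute : ∀ {A : Set} (a? : Dec A) → ⌊ a? ⌋ ≡ false → ¬ A
⌊⌋-refute (no ¬a) _ = ¬a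

⌊⌋-⇔ : ∀ {A B : Set} → (A → B) → (B → A) → (a? : Dec A) (b? : Dec B) → ⌊ a? ⌋ ≡ ⌊ b? ⌋
⌊⌋-⇔ f g a? b? = trans (isYes≗does a?) (trans (does-⇔ (mk⇔ f g) a? b?) (sym (isYes≗does b?)))

infix 7 _==_
_==_ : ∀ {n} → Fin n → Fin n → Bool
a == b = ⌊ a ≟ b ⌋

==-refl : ∀ {n} (a : Fin n) → (a == a) ≡ true
==-refl a = ⌊⌋-true (a ≟ a) refl

==-no : ∀ {n} {a b : Fin n} → a ≢ b → (a == b) ≡ false
==-no {a = a} {b} = ⌊⌋-false (a ≟ b)

==-suc : ∀ {n} (a b : Fin n) → (suc a == suc b) ≡ (a == b)
==-suc a b = ⌊⌋-⇔ suc-injective (cong suc) (suc a ≟ suc b) (a ≟ b)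

true≢false : true ≢ false
true≢false ()

∧-true : ∀ {a b} → a ∧ b ≡ true → a ≡ true × b ≡ true
∧-true {true} {true} _ = refl , refl

not-true : ∀ {b} → not b ≡ true → b ≡ false
not-true {false} _ = refl

≢-from-not : ∀ {n} {a b : Fin n} → not (a == b) ≡ true → a ≢ b
≢-from-not {a = a} {b} ne a≡b = true≢false (trans (sym ne) (cong not (⌊⌋-true (a ≟ b) a≡b)))

bit : Bool → ℕ
bit true  = 1
bit false = 0

count : ∀ {n} → (Fin n → Bool) → ℕ
count {zero}  f = 0
count {suc n} f = bit (f zero) + count (λ v → f (suc v))

count-tabulate : ∀ {n} (f : Fin n → Bool) → ∣ tabulate f ∣ ≡ count f
count-tabulate {zero}  f = refl
count-tabulate {suc n} f with f zero
... | true  = cong suc (count-tabulate (λ v → f (suc v)))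
... | false = count-tabulate (λ v → f (suc v))

count-ext : ∀ {n} {f g : Fin n → Bool} → (∀ v → f v ≡ g v) → count f ≡ count g
count-ext {zero}  e = refl
count-ext {suc n} e = cong₂ _+_ (cong bit (e zero)) (count-ext (λ v → e (suc v)))

infix 4 _⊆ᵇ_
_⊆ᵇ_ : ∀ {n} → (Fin n → Bool) → (Fin n → Bool) → Set
f ⊆ᵇ g = ∀ v → f v ≡ true → g v ≡ true

bit-mono : ∀ {a b} → (a ≡ true → b ≡ true) → bit a ≤ bit b
bit-mono {false} _ = z≤n
bit-mono {true}  a⇒b rewrite a⇒b refl = ≤-refl

count-mono : ∀ {n} {f g : Fin n → Bool} → f ⊆ᵇ g → count f ≤ count g
count-mono {zero}  f⊆g = z≤n
count-mono {suc n} f⊆g = +-mono-≤ (bit-mono (f⊆g zero)) (count-mono (λ v → f⊆g (suc v)))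

count-none : ∀ {n} {f : Fin n → Bool} → (∀ v → f v ≡ false) → count f ≡ 0
count-none {zero}  none = refl
count-none {suc n} none rewrite none zero = count-none (λ v → none (suc v))

count-zero : ∀ {n} (f : Fin n → Bool) → count f ≡ 0 → ∀ v → f v ≡ false
count-zero {suc n} f c≡0 zero with f zero
... | false = refl
count-zero {suc n} f c≡0 (suc v) =
  count-zero (λ w → f (suc w)) (m+n≡0⇒n≡0 (bit (f zero)) c≡0) v

bit-not : ∀ a → bit a + bit (not a) ≡ 1
bit-not true  = refl
bit-not false = refl

count-complement : ∀ {n} (f : Fin n → Bool) → count f + count (λ v → not (f v)) ≡ n
count-complement {zero}  f = refl
count-complement {suc n} f = begin
  (bit a + c) + (bit (not a) + c')  ≡⟨ interchange (bit a) c (bit (not a)) c' ⟩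
  (bit a + bit (not a)) + (c + c')  ≡⟨ cong₂ _+_ (bit-not a) (count-complement (λ v → f (suc v))) ⟩
  suc n                              ∎
  where
  open ≡-Reasoning
  a : Bool
  a = f zero
  c c' : ℕ
  c = count (λ v → f (suc v))
  c' = count (λ v → not (f (suc v)))

infixl 6 _∖_
_∖_ : ∀ {n} → (Fin n → Bool) → Fin n → Fin n → Bool
(f ∖ p) v = not (v == p) ∧ f v

count-remove : ∀ {n} (f : Fin n → Bool) p → count f ≡ bit (f p) + count (f ∖ p)
count-remove {suc n} f zero    = refl
count-remove {suc n} f (suc q) = begin
  bit (f zero) + count f'                            ≡⟨ cong (bit (f zero) +_) (count-remove f' q) ⟩
  bit (f zero) + (bit (f (suc q)) + count (f' ∖ q))  ≡⟨ x∙yz≈y∙xz (bit (f zero)) (bit (f (suc q))) (count (f' ∖ q)) ⟩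
  bit (f (suc q)) + (bit (f zero) + count (f' ∖ q))
    ≡⟨ cong (λ c → bit (f (suc q)) + (bit (f zero) + c))
            (count-ext (λ v → cong (λ b → not b ∧ f (suc v)) (sym (==-suc v q)))) ⟩
  bit (f (suc q)) + count (f ∖ suc q)                ∎
  where
  open ≡-Reasoning
  f' : Fin n → Bool
  f' v = f (suc v)

remove-agree : ∀ {n} {f g : Fin n → Bool} p {v} → (v ≢ p → f v ≡ g v) → (f ∖ p) v ≡ (g ∖ p) v
remove-agree p {v} agree with v ≟ p
... | yes _  = refl
... | no v≢p = agree v≢p

count-remove₂ : ∀ {n} (f : Fin n → Bool) {p q} → p ≢ q →
                count f ≡ bit (f p) + (bit (f q) + count (f ∖ p ∖ q))
count-remove₂ f {p} {q} p≢q = begin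
  count f                                            ≡⟨ count-remove f p ⟩
  bit (f p) + count (f ∖ p)                          ≡⟨ cong (bit (f p) +_) (count-remove (f ∖ p) q) ⟩
  bit (f p) + (bit ((f ∖ p) q) + count (f ∖ p ∖ q))  ≡⟨ cong (λ b → bit (f p) + (bit (not b ∧ f q) + count (f ∖ p ∖ q)))
                                                           (==-no (≢-sym p≢q)) ⟩
  bit (f p) + (bit (f q) + count (f ∖ p ∖ q))        ∎
  where open ≡-Reasoning

-- Trading one true value for another, everything else unchanged, keeps
-- the count.  This is why a 2-switch preserves every degree.
count-exchange : ∀ {n} {f g : Fin n → Bool} p q → (∀ v → v ≢ p → v ≢ q → f v ≡ g v) →
                 f p ≡ true → f q ≡ false → g p ≡ false → g q ≡ true → count f ≡ count g
count-exchange {f = f} {g} p q agree fp fq gp gq = begin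
  count f                                      ≡⟨ count-remove₂ f p≢q ⟩
  bit (f p) + (bit (f q) + count (f ∖ p ∖ q))  ≡⟨ cong₂ (λ a b → bit a + (bit b + count (f ∖ p ∖ q))) fp fq ⟩
  suc (count (f ∖ p ∖ q))                      ≡⟨ cong suc (count-ext rest-agree) ⟩
  suc (count (g ∖ p ∖ q))                      ≡⟨ cong₂ (λ a b → bit a + (bit b + count (g ∖ p ∖ q))) gp gq ⟨
  bit (g p) + (bit (g q) + count (g ∖ p ∖ q))  ≡⟨ count-remove₂ g p≢q ⟨
  count g                                      ∎
  where
  open ≡-Reasoning
  p≢q : p ≢ q
  p≢q refl = true≢false (trans (sym fp) fq)
  rest-agree : ∀ v → (f ∖ p ∖ q) v ≡ (g ∖ p ∖ q) v
  rest-agree v = remove-agree {f = f ∖ p} {g ∖ p} q (λ v≢q → remove-agree {f = f} {g} p (λ v≢p → agree v v≢p v≢q))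

count-extend : ∀ {n} {f g : Fin n → Bool} p → (∀ v → v ≢ p → f v ≡ g v) → g p ≡ false →
               count f ≡ bit (f p) + count g
count-extend {f = f} {g} p agree gp = begin
  count f                    ≡⟨ count-remove f p ⟩
  bit (f p) + count (f ∖ p)  ≡⟨ cong (bit (f p) +_) (count-ext (λ v → remove-agree {f = f} {g} p (agree v))) ⟩
  bit (f p) + count (g ∖ p)  ≡⟨ cong (λ b → bit (f p) + (bit b + count (g ∖ p))) gp ⟨
  bit (f p) + (bit (g p) + count (g ∖ p))  ≡⟨ cong (bit (f p) +_) (count-remove g p) ⟨
  bit (f p) + count g        ∎
  where open ≡-Reasoning

remove-mono : ∀ {n} {f g : Fin n → Bool} {p} → f ⊆ᵇ g → f ∖ p ⊆ᵇ g ∖ p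
remove-mono {p = p} f⊆g v e with v == p
remove-mono f⊆g v () | true
remove-mono f⊆g v e  | false = f⊆g v e

count-strict : ∀ {n} {f g : Fin n → Bool} p → f ⊆ᵇ g → f p ≡ false → g p ≡ true → count f < count g
count-strict {f = f} {g} p f⊆g fp gp = begin-strict
  count f                    ≡⟨ count-remove f p ⟩
  bit (f p) + count (f ∖ p)  ≡⟨ cong (λ b → bit b + count (f ∖ p)) fp ⟩
  count (f ∖ p)              ≤⟨ count-mono (remove-mono f⊆g) ⟩
  count (g ∖ p)              <⟨ n<1+n (count (g ∖ p)) ⟩
  suc (count (g ∖ p))        ≡⟨ cong (λ b → bit b + count (g ∖ p)) gp ⟨
  bit (g p) + count (g ∖ p)  ≡⟨ count-remove g p ⟨
  count g                    ∎
  where open ≤-Reasoning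

Outside : ∀ {n} → (Fin n → Bool) → (Fin n → Bool) → Set
Outside {n} f g = Σ (Fin n) λ v → f v ≡ true × g v ≡ false

outside? : ∀ {n} (f g : Fin n → Bool) → Dec (Outside f g)
outside? f g = any? (λ v → (f v Bool.≟ true) ×-dec (g v Bool.≟ false))

no-outside : ∀ {n} {f g : Fin n → Bool} → ¬ Outside f g → f ⊆ᵇ g
no-outside {g = g} ¬out v fv with g v in gv
... | true  = refl
... | false = ⊥-elim (¬out (v , fv , gv))

count-exists : ∀ {n} {f g : Fin n → Bool} → count g < count f → Outside f g
count-exists {f = f} {g} g<f with outside? f g
... | yes out  = out
... | no ¬out = ⊥-elim (<⇒≱ g<f (count-mono (no-outside ¬out)))

count-balance : ∀ {n} {f g : Fin n → Bool} → count f ≡ count g → Outside f g → Outside g f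
count-balance {f = f} {g} f≡g (p , fp , gp) with outside? g f
... | yes out  = out
... | no ¬out = ⊥-elim (<⇒≢ (count-strict p (no-outside ¬out) gp fp) (sym f≡g))

count-⊆-≡ : ∀ {n} {f g : Fin n → Bool} → f ⊆ᵇ g → count f ≡ count g → ∀ v → f v ≡ g v
count-⊆-≡ {f = f} {g} f⊆g f≡g v with f v in fv | g v in gv
... | true  | true  = refl
... | false | false = refl
... | true  | false = ⊥-elim (true≢false (trans (sym (f⊆g v fv)) gv))
... | false | true  = ⊥-elim (<⇒≢ (count-strict v f⊆g fv gv) f≡g)

<?-suc : ∀ x y → ⌊ suc x <? suc y ⌋ ≡ ⌊ x <? y ⌋
<?-suc x y = ⌊⌋-⇔ s<s⁻¹ s<s (suc x <? suc y) (x <? y)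

<?-shift : ∀ b r D → ⌊ bit b + r <? D ⌋ ≡ ⌊ r <? D ∸ bit b ⌋
<?-shift false r D       = refl
<?-shift true  r zero    = refl
<?-shift true  r (suc D) = <?-suc r D

-- The leftmost selection.  rank a k counts the vertices of a lying to the
-- left of k, and first a D keeps the vertices of a of rank below D, i.e.
-- the D leftmost vertices of a (Defs' leftmost is this for allowed X i).
rank : ∀ {n} → (Fin n → Bool) → Fin n → ℕ
rank a k = count (λ j → a j ∧ ⌊ toℕ j <? toℕ k ⌋)

first : ∀ {n} → (Fin n → Bool) → ℕ → Fin n → Bool
first a D k = a k ∧ ⌊ rank a k <? D ⌋

rank-zero : ∀ {n} (a : Fin (suc n) → Bool) → rank a zero ≡ 0
rank-zero a = count-none (λ j → ∧-zeroʳ (a j))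

rank-suc : ∀ {n} (a : Fin (suc n) → Bool) k → rank a (suc k) ≡ bit (a zero) + rank (λ v → a (suc v)) k
rank-suc a k = cong₂ _+_ (cong bit (∧-identityʳ (a zero)))
                         (count-ext (λ j → cong (a (suc j) ∧_) (<?-suc (toℕ j) (toℕ k))))

first-suc : ∀ {n} (a : Fin (suc n) → Bool) D k →
            first a D (suc k) ≡ first (λ v → a (suc v)) (D ∸ bit (a zero)) k
first-suc a D k = cong (a (suc k) ∧_)
  (trans (cong (λ r → ⌊ r <? D ⌋) (rank-suc a k)) (<?-shift (a zero) (rank (λ v → a (suc v)) k) D))

take-step : ∀ b D c → bit (b ∧ ⌊ 0 <? D ⌋) + (D ∸ bit b) ⊓ c ≡ D ⊓ (bit b + c)
take-step false D       c = refl
take-step true  zero    c = refl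
take-step true  (suc D) c = refl

count-first : ∀ {n} (a : Fin n → Bool) D → count (first a D) ≡ D ⊓ count a
count-first {zero}  a D = sym (⊓-zeroʳ D)
count-first {suc n} a D = begin
  bit (first a D zero) + count (λ k → first a D (suc k))
    ≡⟨ cong₂ _+_ (cong (λ r → bit (a zero ∧ ⌊ r <? D ⌋)) (rank-zero a)) (count-ext (first-suc a D)) ⟩
  bit (a zero ∧ ⌊ 0 <? D ⌋) + count (first a' (D ∸ bit (a zero)))
    ≡⟨ cong (bit (a zero ∧ ⌊ 0 <? D ⌋) +_) (count-first a' (D ∸ bit (a zero))) ⟩
  bit (a zero ∧ ⌊ 0 <? D ⌋) + (D ∸ bit (a zero)) ⊓ count a'
    ≡⟨ take-step (a zero) D (count a') ⟩
  D ⊓ count a ∎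
  where
  open ≡-Reasoning
  a' : Fin n → Bool
  a' v = a (suc v)

rank-mono : ∀ {n} (a : Fin n → Bool) {j l} → toℕ j ≤ toℕ l → rank a j ≤ rank a l
rank-mono a {j} {l} j≤l = count-mono below
  where
  below : (λ v → a v ∧ ⌊ toℕ v <? toℕ j ⌋) ⊆ᵇ (λ v → a v ∧ ⌊ toℕ v <? toℕ l ⌋)
  below v e with ∧-true e
  ... | av , v<j = cong₂ _∧_ av (⌊⌋-true (toℕ v <? toℕ l) (<-≤-trans (⌊⌋-sound (toℕ v <? toℕ j) v<j) j≤l))

first-leftmost : ∀ {n} (a : Fin n → Bool) D {l j} →
                 first a D l ≡ true → a j ≡ true → first a D j ≡ false → toℕ l ≤ toℕ j
first-leftmost a D {l} {j} chosen aj skipped = ≮⇒≥ j≮l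
  where
  j≮l : ¬ toℕ j < toℕ l
  j≮l j<l = ⌊⌋-refute (rank a j <? D) (trans (cong (_∧ ⌊ rank a j <? D ⌋) (sym aj)) skipped)
              (≤-<-trans (rank-mono a (<⇒≤ j<l)) (⌊⌋-sound (rank a l <? D) (proj₂ (∧-true chosen))))

edge-ends : ∀ {n} (G : SimpleGraph n) {u v} → adj G u v ≡ true → u ≢ v
edge-ends G {u} uv refl = true≢false (trans (sym uv) (loopless G u))

pair : ∀ {n} → Fin n → Fin n → Fin n → Fin n → Bool
pair u v a b = (u == a ∧ v == b) ∨ (u == b ∧ v == a)

pair-sym : ∀ {n} (u v a b : Fin n) → pair u v a b ≡ pair v u a b
pair-sym u v a b = trans (cong₂ _∨_ (∧-comm (u == a) (v == b)) (∧-comm (u == b) (v == a)))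
                         (∨-comm (v == b ∧ u == a) (v == a ∧ u == b))

-- The 2-switch.  Given edges ij, lk and non-edges il, jk, replace ij, lk
-- by il, jk.  Every vertex loses one neighbour and gains another, so all
-- degrees are preserved.
module Switch {n} (G : SimpleGraph n) (i j l k : Fin n)
  (ij-edge : adj G i j ≡ true) (lk-edge : adj G l k ≡ true)
  (il-free : adj G i l ≡ false) (jk-free : adj G j k ≡ false)
  (i≢l : i ≢ l) (j≢k : j ≢ k) where

  i≢j : i ≢ j
  i≢j = edge-ends G ij-edge
  l≢k : l ≢ k
  l≢k = edge-ends G lk-edge
  i≢k : i ≢ k
  i≢k refl = true≢false (trans (sym lk-edge) (trans (symmetric G l i) il-free))
  j≢l : j ≢ l
  j≢l refl = true≢false (trans (sym ij-edge) il-free)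

  switched : Fin n → Fin n → Bool
  switched u v = if pair u v i j ∨ pair u v l k then false
                 else if pair u v i l ∨ pair u v j k then true
                 else adj G u v

  switched-sym : ∀ u v → switched u v ≡ switched v u
  switched-sym u v rewrite pair-sym u v i j | pair-sym u v l k | pair-sym u v i l | pair-sym u v j k
                         | symmetric G u v = refl

  row-i : ∀ v → v ≢ j → v ≢ l → switched i v ≡ adj G i v
  row-i v v≢j v≢l rewrite ==-refl i | ==-no i≢j | ==-no i≢l | ==-no i≢k | ==-no v≢j | ==-no v≢l = refl
  row-ij : switched i j ≡ false
  row-ij rewrite ==-refl i | ==-refl j = refl
  row-il : switched i l ≡ true
  row-il rewrite ==-refl i | ==-refl l | ==-no i≢j | ==-no i≢l | ==-no i≢k | ==-no (≢-sym j≢l) = refl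

  row-j : ∀ v → v ≢ i → v ≢ k → switched j v ≡ adj G j v
  row-j v v≢i v≢k rewrite ==-refl j | ==-no (≢-sym i≢j) | ==-no j≢l | ==-no j≢k | ==-no v≢i | ==-no v≢k = refl
  row-ji : switched j i ≡ false
  row-ji rewrite ==-refl i | ==-refl j | ==-no (≢-sym i≢j) = refl
  row-jk : switched j k ≡ true
  row-jk rewrite ==-refl j | ==-refl k | ==-no (≢-sym i≢j) | ==-no j≢l | ==-no j≢k | ==-no (≢-sym i≢k) = refl

  row-l : ∀ v → v ≢ k → v ≢ i → switched l v ≡ adj G l v
  row-l v v≢k v≢i rewrite ==-refl l | ==-no (≢-sym i≢l) | ==-no (≢-sym j≢l) | ==-no l≢k | ==-no v≢k | ==-no v≢i = refl
  row-lk : switched l k ≡ false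
  row-lk rewrite ==-refl l | ==-refl k | ==-no (≢-sym i≢l) | ==-no (≢-sym j≢l) = refl
  row-li : switched l i ≡ true
  row-li rewrite ==-refl l | ==-refl i | ==-no (≢-sym i≢l) | ==-no (≢-sym j≢l) | ==-no l≢k | ==-no i≢k = refl

  row-k : ∀ v → v ≢ l → v ≢ j → switched k v ≡ adj G k v
  row-k v v≢l v≢j rewrite ==-refl k | ==-no (≢-sym i≢k) | ==-no (≢-sym j≢k) | ==-no (≢-sym l≢k) | ==-no v≢l | ==-no v≢j = refl
  row-kl : switched k l ≡ false
  row-kl rewrite ==-refl k | ==-refl l | ==-no (≢-sym i≢k) | ==-no (≢-sym j≢k) | ==-no (≢-sym l≢k) = refl
  row-kj : switched k j ≡ true
  row-kj rewrite ==-refl k | ==-refl j | ==-no (≢-sym i≢k) | ==-no (≢-sym j≢k) | ==-no (≢-sym l≢k) | ==-no j≢l = refl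

  row-other : ∀ u v → u ≢ i → u ≢ j → u ≢ l → u ≢ k → switched u v ≡ adj G u v
  row-other u v u≢i u≢j u≢l u≢k rewrite ==-no u≢i | ==-no u≢j | ==-no u≢l | ==-no u≢k = refl

  data Role : Fin n → Set where
    at-i  : Role i
    at-j  : Role j
    at-l  : Role l
    at-k  : Role k
    other : ∀ {u} → u ≢ i → u ≢ j → u ≢ l → u ≢ k → Role u

  role : ∀ u → Role u
  role u with u ≟ i | u ≟ j | u ≟ l | u ≟ k
  ... | yes refl | _        | _        | _        = at-i
  ... | no _     | yes refl | _        | _        = at-j
  ... | no _     | no _     | yes refl | _        = at-l
  ... | no _     | no _     | no _     | yes refl = at-k
  ... | no u≢i   | no u≢j   | no u≢l   | no u≢k   = other u≢i u≢j u≢l u≢k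

  switched-loopless : ∀ u → switched u u ≡ false
  switched-loopless u with role u
  ... | at-i = trans (row-i i i≢j i≢l) (loopless G i)
  ... | at-j = trans (row-j j (≢-sym i≢j) j≢k) (loopless G j)
  ... | at-l = trans (row-l l l≢k (≢-sym i≢l)) (loopless G l)
  ... | at-k = trans (row-k k (≢-sym l≢k) (≢-sym j≢k)) (loopless G k)
  ... | other u≢i u≢j u≢l u≢k = trans (row-other u u u≢i u≢j u≢l u≢k) (loopless G u)

  switched-degree : ∀ u → count (adj G u) ≡ count (switched u)
  switched-degree u with role u
  ... | at-i = count-exchange j l (λ v v≢j v≢l → sym (row-i v v≢j v≢l)) ij-edge il-free row-ij row-il
  ... | at-j = count-exchange i k (λ v v≢i v≢k → sym (row-j v v≢i v≢k))
                 (trans (symmetric G j i) ij-edge) jk-free row-ji row-jk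
  ... | at-l = count-exchange k i (λ v v≢k v≢i → sym (row-l v v≢k v≢i))
                 lk-edge (trans (symmetric G l i) il-free) row-lk row-li
  ... | at-k = count-exchange l j (λ v v≢l v≢j → sym (row-k v v≢l v≢j))
                 (trans (symmetric G k l) lk-edge) (trans (symmetric G k j) jk-free) row-kl row-kj
  ... | other u≢i u≢j u≢l u≢k = count-ext (λ v → sym (row-other u v u≢i u≢j u≢l u≢k))

  graph : SimpleGraph n
  graph = record { adj = switched ; symmetric = switched-sym ; loopless = switched-loopless }

-- The neighbours of l other than j outnumber those of j other
-- than i and l.
partner : ∀ {n} (G : SimpleGraph n) {i j l} → i ≢ l → adj G i j ≡ true → adj G i l ≡ false →
          count (adj G j) ≤ count (adj G l) →
          Σ (Fin n) λ k → adj G l k ≡ true × adj G j k ≡ false × j ≢ k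
partner {n} G {i} {j} {l} i≢l ij-edge il-free j≤l = k , lk-edge , jk-free , ≢-sym k≢j
  where
  f g : Fin n → Bool
  f = adj G l ∖ j
  g = adj G j ∖ i ∖ l
  b : ℕ
  b = bit (adj G l j)
  g<f : count g < count f
  g<f = +-cancelˡ-≤ b (suc (count g)) (count f) (begin
    b + suc (count g)                                  ≡⟨ +-suc b (count g) ⟩
    suc (b + count g)                                  ≡⟨ cong₂ (λ x y → bit x + (bit y + count g))
                                                              (trans (symmetric G j i) ij-edge) (symmetric G j l) ⟨
    bit (adj G j i) + (bit (adj G j l) + count g)      ≡⟨ count-remove₂ (adj G j) i≢l ⟨
    count (adj G j)                                    ≤⟨ j≤l ⟩
    count (adj G l)                                    ≡⟨ count-remove (adj G l) j ⟩
    b + count f                                        ∎)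
    where open ≤-Reasoning
  witness : Outside f g
  witness = count-exists g<f
  k : Fin n
  k = proj₁ witness
  fk : f k ≡ true
  fk = proj₁ (proj₂ witness)
  lk-edge : adj G l k ≡ true
  lk-edge = proj₂ (∧-true fk)
  k≢j : k ≢ j
  k≢j = ≢-from-not (proj₁ (∧-true fk))
  k≢l : k ≢ l
  k≢l = ≢-sym (edge-ends G lk-edge)
  k≢i : k ≢ i
  k≢i k≡i = true≢false (trans (sym lk-edge) (trans (cong (adj G l) k≡i) (trans (symmetric G l i) il-free)))
  g-at-k : g k ≡ adj G j k
  g-at-k rewrite ==-no k≢l | ==-no k≢i = refl
  jk-free : adj G j k ≡ false
  jk-free = trans (sym g-at-k) (proj₂ (proj₂ witness))

isolate : ∀ {n} → SimpleGraph n → Fin n → SimpleGraph n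
isolate {n} G i = record { adj = A ; symmetric = A-sym ; loopless = A-loopless }
  where
  A : Fin n → Fin n → Bool
  A u v = not (u == i) ∧ (adj G u ∖ i) v
  A-sym : ∀ u v → A u v ≡ A v u
  A-sym u v rewrite symmetric G u v with u == i | v == i
  ... | true  | true  = refl
  ... | true  | false = refl
  ... | false | true  = refl
  ... | false | false = refl
  A-loopless : ∀ u → A u u ≡ false
  A-loopless u with u == i
  ... | true  = refl
  ... | false = loopless G u

isolate-centre : ∀ {n} (G : SimpleGraph n) i → count (adj (isolate G i) i) ≡ 0
isolate-centre {n} G i rewrite ==-refl i = count-none {n} (λ _ → refl)

isolate-degree : ∀ {n} (G : SimpleGraph n) {i k} → k ≢ i →
                 count (adj G k) ≡ bit (adj G i k) + count (adj (isolate G i) k)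
isolate-degree G {i} {k} k≢i rewrite ==-no k≢i | symmetric G i k = count-remove (adj G k) i

attach : ∀ {n} → SimpleGraph n → (i : Fin n) → (L : Fin n → Bool) → L i ≡ false → SimpleGraph n
attach {n} G i L Li = record { adj = A ; symmetric = A-sym ; loopless = A-loopless }
  where
  A : Fin n → Fin n → Bool
  A u v = if u == i then L v else if v == i then L u else adj G u v
  A-sym : ∀ u v → A u v ≡ A v u
  A-sym u v with u ≟ i | v ≟ i
  ... | yes refl | yes refl = refl
  ... | yes refl | no _     = refl
  ... | no _     | yes refl = refl
  ... | no _     | no _     = symmetric G u v
  A-loopless : ∀ u → A u u ≡ false
  A-loopless u with u ≟ i
  ... | yes refl = Li
  ... | no _     = loopless G u

attach-row : ∀ {n} (G : SimpleGraph n) i L (Li : L i ≡ false) v → adj (attach G i L Li) i v ≡ L v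
attach-row G i L Li v rewrite ==-refl i = refl

attach-degree : ∀ {n} (G : SimpleGraph n) i L (Li : L i ≡ false) {k} → k ≢ i → adj G k i ≡ false →
                count (adj (attach G i L Li) k) ≡ bit (L k) + count (adj G k)
attach-degree G i L Li {k} k≢i ki-free = trans (count-extend i agree ki-free) (cong (λ b → bit b + count (adj G k)) at-i)
  where
  agree : ∀ v → v ≢ i → adj (attach G i L Li) k v ≡ adj G k v
  agree v v≢i rewrite ==-no k≢i | ==-no v≢i = refl
  at-i : adj (attach G i L Li) k i ≡ L k
  at-i rewrite ==-no k≢i | ==-refl i = refl

reduceAt : ∀ {n} → (Fin n → ℕ) → Fin n → (Fin n → Bool) → Fin n → ℕ
reduceAt d i L k = if k == i then 0 else if L k then d k ∸ 1 else d k

reduceAt-centre : ∀ {n} (d : Fin n → ℕ) i L → reduceAt d i L i ≡ 0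
reduceAt-centre d i L rewrite ==-refl i = refl

reduceAt-other : ∀ {n} (d : Fin n → ℕ) i L {k} → k ≢ i → reduceAt d i L k ≡ d k ∸ bit (L k)
reduceAt-other d i L {k} k≢i rewrite ==-no k≢i with L k
... | true  = refl
... | false = refl

bit≤1 : ∀ b → bit b ≤ 1
bit≤1 true  = ≤-refl
bit≤1 false = z≤n

module StarRealisation {n} (d : Fin n → ℕ) (i : Fin n) (F L : Fin n → Bool)
  (L-size : count L ≡ d i)
  (L-allowed : ∀ l → L l ≡ true → F l ≡ false × l ≢ i)
  (L-leftmost : ∀ l j → L l ≡ true → L j ≡ false → F j ≡ false → j ≢ i → d j ≤ d l) where

  Realises : SimpleGraph n → Set
  Realises G = (∀ k → count (adj G k) ≡ d k) × (∀ j → F j ≡ true → adj G i j ≡ false)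

  -- The vertices of L not yet adjacent to i; their number is the measure
  -- decreased by the normalisation.
  missing : SimpleGraph n → Fin n → Bool
  missing G v = L v ∧ not (adj G i v)

  L-centre : L i ≡ false
  L-centre with L i in Li
  ... | true  = ⊥-elim (proj₂ (L-allowed i Li) refl)
  ... | false = refl

  L-avoids-F : ∀ j → F j ≡ true → L j ≡ false
  L-avoids-F j Fj with L j in Lj
  ... | true  = ⊥-elim (true≢false (trans (sym Fj) (proj₁ (L-allowed j Lj))))
  ... | false = refl

  joining-reduces : ∀ {G G' l} → L l ≡ true → adj G i l ≡ false → adj G' i l ≡ true →
                    (∀ v → v ≢ l → missing G v ≡ missing G' v) → count (missing G') < count (missing G)
  joining-reduces {G} {G'} {l} Ll il-free il-edge agree = ≤-reflexive (sym (begin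
    count (missing G)                        ≡⟨ count-extend l agree now-joined ⟩
    bit (missing G l) + count (missing G')   ≡⟨ cong (λ b → bit b + count (missing G')) was-missing ⟩
    suc (count (missing G'))                 ∎))
    where
    open ≡-Reasoning
    was-missing : missing G l ≡ true
    was-missing = cong₂ (λ a b → a ∧ not b) Ll il-free
    now-joined : missing G' l ≡ false
    now-joined = cong₂ (λ a b → a ∧ not b) Ll il-edge

  switch-step : ∀ G → Realises G → ∀ {l j} → L l ≡ true → adj G i l ≡ false → adj G i j ≡ true → L j ≡ false →
                Σ (SimpleGraph n) λ G' → Realises G' × count (missing G') < count (missing G)
  switch-step G (deg , avoid) {l} {j} Ll il-free ij-edge Lj =
    S.graph , (degrees , avoids) , joining-reduces {G} {S.graph} Ll il-free S.row-il agree
    where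
    Fl : F l ≡ false
    Fl = proj₁ (L-allowed l Ll)
    l≢i : l ≢ i
    l≢i = proj₂ (L-allowed l Ll)
    Fj : F j ≡ false
    Fj with F j in Fj
    ... | true  = ⊥-elim (true≢false (trans (sym ij-edge) (avoid j Fj)))
    ... | false = refl
    j≤l : count (adj G j) ≤ count (adj G l)
    j≤l = subst₂ _≤_ (sym (deg j)) (sym (deg l))
                 (L-leftmost l j Ll Lj Fj (≢-sym (edge-ends G ij-edge)))
    found : Σ (Fin n) λ k → adj G l k ≡ true × adj G j k ≡ false × j ≢ k
    found = partner G (≢-sym l≢i) ij-edge il-free j≤l
    module S = Switch G i j l (proj₁ found) ij-edge (proj₁ (proj₂ found)) il-free (proj₁ (proj₂ (proj₂ found)))
                      (≢-sym l≢i) (proj₂ (proj₂ (proj₂ found)))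
    degrees : ∀ u → count (adj S.graph u) ≡ d u
    degrees u = trans (sym (S.switched-degree u)) (deg u)
    avoids : ∀ v → F v ≡ true → S.switched i v ≡ false
    avoids v Fv = trans (S.row-i v (λ { refl → true≢false (trans (sym Fv) Fj) })
                                   (λ { refl → true≢false (trans (sym Fv) Fl) }))
                        (avoid v Fv)
    agree : ∀ v → v ≢ l → missing G v ≡ missing S.graph v
    agree v v≢l = by-cases (v ≟ j)
      where
      by-cases : Dec (v ≡ j) → missing G v ≡ missing S.graph v
      by-cases (yes refl) = trans (cong (_∧ not (adj G i j)) Lj) (sym (cong (_∧ not (S.switched i j)) Lj))
      by-cases (no v≢j)   = cong (λ b → L v ∧ not b) (sym (S.row-i v v≢j v≢l))

  StarAt-L : SimpleGraph n → Set
  StarAt-L G = ∀ v → adj G i v ≡ L v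

  -- Every realisation avoiding F can be normalised so that i is joined
  -- exactly to L: by induction on the number of missing vertices, where a
  -- missing vertex of L forces, by equality of sizes, a neighbour outside L.
  normalise : ∀ G → Realises G → Σ (SimpleGraph n) λ H → Realises H × StarAt-L H
  normalise G real = <-rec P go (count (missing G)) G real refl
    where
    P : ℕ → Set
    P m = ∀ G → Realises G → count (missing G) ≡ m → Σ (SimpleGraph n) λ H → Realises H × StarAt-L H
    go : ∀ m → (∀ {m'} → m' < m → P m') → P m
    go _ rec G real refl with outside? L (adj G i)
    ... | no ¬missing = G , real , λ v → sym (count-⊆-≡ (no-outside ¬missing) sizes v)
      where
      sizes : count L ≡ count (adj G i)
      sizes = trans L-size (sym (proj₁ real i))
    ... | yes (l , Ll , il-free) with count-balance (trans L-size (sym (proj₁ real i))) (l , Ll , il-free)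
    ...   | j , ij-edge , Lj with switch-step G real Ll il-free ij-edge Lj
    ...     | G' , real' , fewer = rec fewer G' real' refl

  forward : Σ (SimpleGraph n) Realises → Σ (SimpleGraph n) λ G' → ∀ k → count (adj G' k) ≡ reduceAt d i L k
  forward (G , real) with normalise G real
  ... | H , (deg , _) , star = isolate H i , degrees
    where
    degrees : ∀ k → count (adj (isolate H i) k) ≡ reduceAt d i L k
    degrees k = by-cases (k ≟ i)
      where
      by-cases : Dec (k ≡ i) → count (adj (isolate H i) k) ≡ reduceAt d i L k
      by-cases (yes refl) = trans (isolate-centre H i) (sym (reduceAt-centre d i L))
      by-cases (no k≢i) = begin
        count (adj (isolate H i) k)                                ≡⟨ m+n∸m≡n (bit (L k)) _ ⟨
        bit (L k) + count (adj (isolate H i) k) ∸ bit (L k)        ≡⟨ cong (λ b → bit b + _ ∸ bit (L k)) (star k) ⟨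
        bit (adj H i k) + count (adj (isolate H i) k) ∸ bit (L k)  ≡⟨ cong (_∸ bit (L k)) (isolate-degree H k≢i) ⟨
        count (adj H k) ∸ bit (L k)                                ≡⟨ cong (_∸ bit (L k)) (deg k) ⟩
        d k ∸ bit (L k)                                            ≡⟨ reduceAt-other d i L k≢i ⟨
        reduceAt d i L k                                           ∎
        where open ≡-Reasoning

  backward : (∀ k → d k ≥ 1) → (Σ (SimpleGraph n) λ G' → ∀ k → count (adj G' k) ≡ reduceAt d i L k) →
             Σ (SimpleGraph n) Realises
  backward positive (G' , deg') = G , degrees , avoids
    where
    G : SimpleGraph n
    G = attach G' i L L-centre
    i-isolated : ∀ v → adj G' i v ≡ false
    i-isolated = count-zero (adj G' i) (trans (deg' i) (reduceAt-centre d i L))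
    degrees : ∀ k → count (adj G k) ≡ d k
    degrees k = by-cases (k ≟ i)
      where
      by-cases : Dec (k ≡ i) → count (adj G k) ≡ d k
      by-cases (yes refl) = trans (count-ext (attach-row G' i L L-centre)) L-size
      by-cases (no k≢i) = begin
        count (adj G k)                  ≡⟨ attach-degree G' i L L-centre k≢i (trans (symmetric G' k i) (i-isolated k)) ⟩
        bit (L k) + count (adj G' k)     ≡⟨ cong (bit (L k) +_) (trans (deg' k) (reduceAt-other d i L k≢i)) ⟩
        bit (L k) + (d k ∸ bit (L k))    ≡⟨ m+[n∸m]≡n (≤-trans (bit≤1 (L k)) (positive k)) ⟩
        d k                              ∎
        where open ≡-Reasoning
    avoids : ∀ j → F j ≡ true → adj G i j ≡ false
    avoids j Fj = trans (attach-row G' i L L-centre j) (L-avoids-F j Fj)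

leftmost-first : ∀ {n} (X : Subset n) i D k → lookup (leftmost X i D) k ≡ first (allowed X i) D k
leftmost-first X i D k =
  trans (lookup∘tabulate _ k)
        (cong (λ r → allowed X i k ∧ ⌊ r <? D ⌋) (count-tabulate (λ j → allowed X i j ∧ ⌊ toℕ j <? toℕ k ⌋)))

size-count : ∀ {n} (X : Subset n) → ∣ X ∣ ≡ count (lookup X)
size-count X = trans (cong ∣_∣ (sym (tabulate∘lookup X))) (count-tabulate (lookup X))

count-allowed : ∀ {n} (X : Subset n) i → lookup X i ≡ false → ∣ X ∣ + suc (count (allowed X i)) ≡ n
count-allowed {n} X i Xi = begin
  ∣ X ∣ + suc (count (allowed X i))          ≡⟨ cong₂ _+_ (size-count X) (cong suc (count-ext (λ v → ∧-comm (not (lookup X v)) (not (v == i))))) ⟩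
  count (lookup X) + suc (count (outX ∖ i))   ≡⟨ cong (λ b → count (lookup X) + (bit (not b) + count (outX ∖ i))) Xi ⟨
  count (lookup X) + (bit (outX i) + count (outX ∖ i)) ≡⟨ cong (count (lookup X) +_) (count-remove outX i) ⟨
  count (lookup X) + count outX               ≡⟨ count-complement (lookup X) ⟩
  n                                           ∎
  where
  open ≡-Reasoning
  outX : Fin n → Bool
  outX v = not (lookup X v)

leftmost-size : ∀ {n} (X : Subset n) i D → lookup X i ≡ false → ∣ X ∣ + D + 1 ≤ n →
                count (lookup (leftmost X i D)) ≡ D
leftmost-size X i D Xi bound = begin
  count (lookup (leftmost X i D))  ≡⟨ count-ext (leftmost-first X i D) ⟩
  count (first (allowed X i) D)    ≡⟨ count-first (allowed X i) D ⟩
  D ⊓ count (allowed X i)          ≡⟨ m≤n⇒m⊓n≡m D≤allowed ⟩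
  D                                ∎
  where
  open ≡-Reasoning
  D≤allowed : D ≤ count (allowed X i)
  D≤allowed = s≤s⁻¹ (+-cancelˡ-≤ ∣ X ∣ (suc D) (suc (count (allowed X i)))
    (subst₂ _≤_ (trans (+-assoc ∣ X ∣ D 1) (cong (∣ X ∣ +_) (+-comm D 1))) (sym (count-allowed X i Xi)) bound))

leftmost-allowed : ∀ {n} (X : Subset n) i D l → lookup (leftmost X i D) l ≡ true → lookup X l ≡ false × l ≢ i
leftmost-allowed X i D l chosen = not-true (proj₁ allowed-l) , ≢-from-not (proj₂ allowed-l)
  where
  allowed-l : not (lookup X l) ≡ true × not (l == i) ≡ true
  allowed-l = ∧-true (proj₁ (∧-true (trans (sym (leftmost-first X i D l)) chosen)))

leftmost-heaviest : ∀ {n} (d : Fin n → ℕ) → NonIncreasing d → (X : Subset n) → ∀ i D {l j} →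
                    lookup (leftmost X i D) l ≡ true → lookup (leftmost X i D) j ≡ false →
                    lookup X j ≡ false → j ≢ i → d j ≤ d l
leftmost-heaviest d nonIncreasing X i D {l} {j} chosen skipped Xj j≢i =
  nonIncreasing l j (first-leftmost (allowed X i) D (trans (sym (leftmost-first X i D l)) chosen)
                                    (cong₂ (λ x y → not x ∧ not y) Xj (==-no j≢i))
                                    (trans (sym (leftmost-first X i D j)) skipped))

reduced-as-reduceAt : ∀ {n} (d : Fin n → ℕ) X i k → reduced d X i k ≡ reduceAt d i (lookup (leftmost X i (d i))) k
reduced-as-reduceAt d X i k with ⌊ k ≟ i ⌋ | lookup (leftmost X i (d i)) k
... | true  | _     = refl
... | false | true  = refl
... | false | false = refl

∉⇒lookup-false : ∀ {n} {i : Fin n} (X : Subset n) → i ∉ X → lookup X i ≡ false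
∉⇒lookup-false {i = i} X i∉X with lookup X i in Xi
... | true  = ⊥-elim (i∉X (lookup⇒[]= i X Xi))
... | false = refl

degree-count : ∀ {n} (G : SimpleGraph n) k → degree G k ≡ count (adj G k)
degree-count G k = count-tabulate (adj G k)

theorem3 : (n : ℕ) → n ≥ 2 → (d : Fin n → ℕ) → NonIncreasing d → (∀ k → d k ≥ 1) →
    (i : Fin n) → (m : ℕ) → m + d i + 1 ≤ n →
    (X : Subset n) → ∣ X ∣ ≡ m → i ∉ X →
    (Σ (SimpleGraph n) (λ G → (∀ k → degree G k ≡ d k) × (∀ j → j ∈ X → adj G i j ≡ false)))
      ⇔ Graphical (reduced d X i)
theorem3 n _ d nonIncreasing positive i m bound X ∣X∣≡m i∉X = mk⇔ to from
  where
  Xi : lookup X i ≡ false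
  Xi = ∉⇒lookup-false X i∉X
  open StarRealisation d i (lookup X) (lookup (leftmost X i (d i)))
    (leftmost-size X i (d i) Xi (subst (λ s → s + d i + 1 ≤ n) (sym ∣X∣≡m) bound))
    (leftmost-allowed X i (d i))
    (λ l j → leftmost-heaviest d nonIncreasing X i (d i))
  to : Σ (SimpleGraph n) (λ G → (∀ k → degree G k ≡ d k) × (∀ j → j ∈ X → adj G i j ≡ false)) →
       Graphical (reduced d X i)
  to (G , deg , avoid) with forward (G , (λ k → trans (sym (degree-count G k)) (deg k)) , λ j Xj → avoid j (lookup⇒[]= j X Xj))
  ... | G' , deg' = G' , λ k → trans (degree-count G' k) (trans (deg' k) (sym (reduced-as-reduceAt d X i k)))
  from : Graphical (reduced d X i) →
         Σ (SimpleGraph n) (λ G → (∀ k → degree G k ≡ d k) × (∀ j → j ∈ X → adj G i j ≡ false))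
  from (G' , deg') with backward positive (G' , λ k → trans (sym (degree-count G' k)) (trans (deg' k) (reduced-as-reduceAt d X i k)))
  ... | G , deg , avoid = G , (λ k → trans (degree-count G k) (deg k)) , λ j j∈X → avoid j ([]=⇒lookup j∈X)
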